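{- Let $S=\mathcal{P}_S\cup\mathcal{L}_S$ be a resolving set for a biaffine plane $B_q$ of order $q$ ($\mathcal{P}_S$ points, $\mathcal{L}_S$ lines), let $u$ be the number of uncovered directions and $c$ the number of unblocked non-adjacency classes. Then \[|\mathcal{P}_S|\geq \frac{u}{u+1}\,2(q-1)\quad\text{and}\quad |\mathcal{L}_S|\geq \frac{c}{c+1}\,2(q-1).\]
   Context: A biaffine plane of order $q$ is obtained from an affine plane of order $q$ by deleting all lines of one parallel class (keeping all points). Its directions are the $q$ remaining parallel classes of lines; its non-adjacency classes are the $q$ point sets of the deleted lines. A resolving set is a vertex set $S$ of its incidence graph (bipartite graph on points and lines, adjacency = incidence) such that every two distinct vertices $u\neq v$ have some $x\in S$ with $d(u,x)\neq d(v,x)$. A direction is uncovered if $\mathcal{L}_S$ contains no line of that parallel class; a non-adjacency class is unblocked if it contains no point of $\mathcal{P}_S$. -}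

module Defs where

open import Data.Nat using (ℕ; zero; suc; _+_; _<ᵇ_)
open import Data.Fin using (Fin; toℕ) renaming (zero to fzero; suc to fsuc)
open import Data.Fin.Properties using (_≟_)
open import Data.Bool using (Bool; true; false; _∧_; _∨_; not; if_then_else_)
open import Data.Product using (Σ; ∃; _×_; _,_; proj₁)
open import Data.Sum using (_⊎_; inj₁; inj₂)
open import Data.Empty using (⊥)
open import Relation.Binary.PropositionalEquality using (_≡_; _≢_)
open import Relation.Nullary.Decidable using (⌊_⌋)

countB : {n : ℕ} → (Fin n → Bool) → ℕ
countB {zero}  f = 0
countB {suc n} f = (if f fzero then 1 else 0) + countB (λ i → f (fsuc i))

anyB : {n : ℕ} → (Fin n → Bool) → Bool
anyB {zero}  f = false
anyB {suc n} f = f fzero ∨ anyB (λ i → f (fsuc i))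

record AffinePlane (q : ℕ) : Set where
  field
    np nl : ℕ
    inc   : Fin np → Fin nl → Bool
  meet : Fin nl → Fin nl → Bool
  meet l m = anyB (λ p → inc p l ∧ inc p m)
  field
    join       : ∀ p p' → p ≢ p' → Σ (Fin nl) λ l → inc p l ≡ true × inc p' l ≡ true
    join-uniq  : ∀ p p' → p ≢ p' → ∀ l l' →
                 inc p l ≡ true → inc p' l ≡ true →
                 inc p l' ≡ true → inc p' l' ≡ true → l ≡ l'
    playfair   : ∀ p l → inc p l ≡ false →
                 Σ (Fin nl) λ m → inc p m ≡ true × meet m l ≡ false
    playfair-uniq : ∀ p l → inc p l ≡ false → ∀ m m' →
                 inc p m ≡ true → meet m l ≡ false →
                 inc p m' ≡ true → meet m' l ≡ false → m ≡ m'
    noncollinear : Σ (Fin np) λ a → Σ (Fin np) λ b → Σ (Fin np) λ c →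
                 a ≢ b × a ≢ c × b ≢ c ×
                 (∀ l → inc a l ≡ true → inc b l ≡ true → inc c l ≡ false)
    order      : ∀ l → countB (λ p → inc p l) ≡ q

  par : Fin nl → Fin nl → Bool
  par l m = ⌊ l ≟ m ⌋ ∨ not (meet l m)

-- The biaffine plane obtained from A by deleting the parallel class of ℓ₀,
-- and its incidence graph.

module Biaffine {q : ℕ} (A : AffinePlane q) (ℓ₀ : Fin (AffinePlane.nl A)) where
  open AffinePlane A

  kept : Fin nl → Bool
  kept m = not (par m ℓ₀)

  KeptLine : Set
  KeptLine = Σ (Fin nl) λ m → kept m ≡ true

  Vertex : Set
  Vertex = Fin np ⊎ KeptLine

  Adj : Vertex → Vertex → Set
  Adj (inj₁ p) (inj₁ p') = ⊥
  Adj (inj₁ p) (inj₂ m)  = inc p (proj₁ m) ≡ true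
  Adj (inj₂ m) (inj₁ p)  = inc p (proj₁ m) ≡ true
  Adj (inj₂ m) (inj₂ m') = ⊥

  data Walk : Vertex → Vertex → ℕ → Set where
    here : ∀ {x} → Walk x x 0
    step : ∀ {x y z k} → Adj x y → Walk y z k → Walk x z (suc k)

  Dist : Vertex → Vertex → ℕ → Set
  Dist x y k = Walk x y k × (∀ m → Walk x y m → k Data.Nat.≤ m)

  InS : (Fin np → Bool) → (Fin nl → Bool) → Vertex → Set
  InS PS LS (inj₁ p) = PS p ≡ true
  InS PS LS (inj₂ m) = LS (proj₁ m) ≡ true

  Resolving : (Fin np → Bool) → (Fin nl → Bool) → Set
  Resolving PS LS =
    (∀ m → LS m ≡ true → kept m ≡ true) ×
    (∀ x y → x ≢ y → Σ Vertex λ s → InS PS LS s ×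
       Σ ℕ λ k₁ → Σ ℕ λ k₂ → Dist x s k₁ × Dist y s k₂ × k₁ ≢ k₂)

  -- number of uncovered directions: each direction (parallel class of a kept
  -- line) is counted once via its line of least index
  uncovered : (Fin nl → Bool) → ℕ
  uncovered LS = countB λ m →
    kept m ∧ not (anyB (λ m' → (toℕ m' <ᵇ toℕ m) ∧ par m' m))
           ∧ not (anyB (λ m' → par m m' ∧ LS m'))

  -- number of unblocked non-adjacency classes (deleted lines containing
  -- no point of P_S)
  unblocked : (Fin np → Bool) → ℕ
  unblocked PS = countB λ m →
    par m ℓ₀ ∧ not (anyB (λ p → inc p m ∧ PS p))

-- Fix an uncovered direction. Each of its q lines is at distance 2 from every line of S, so two
-- of them can only be resolved by points of P_S: at most one of them misses P_S, and two lines
-- meeting P_S in exactly one point (tangents) never share that point, even when they belong to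
-- different uncovered directions. Since the lines of a direction partition the points, counting
-- incidences with P_S gives 2(q − 1) ≤ |P_S| + t_d, where t_d is the number of tangents in the
-- direction, while Σ_d t_d ≤ |P_S|; summing over the u uncovered directions gives
-- 2u(q − 1) ≤ (u + 1)|P_S|. Dually, the q points of an unblocked non-adjacency class are at
-- distance 2 from every point of P_S, which gives the same count with the roles of P_S and L_S
-- exchanged.
module Submission where

open import Defs
open import Data.Nat using (ℕ; zero; suc; _+_; _*_; _∸_; _≤_; _<_; z≤n; s≤s; s≤s⁻¹; _≡ᵇ_; _<ᵇ_)
open import Data.Nat.Properties
  using ( +-mono-≤; +-monoˡ-≤; +-monoʳ-≤; *-monoʳ-≤; +-identityʳ; +-comm; *-comm; *-assoc
        ; *-distribˡ-+; *-distribˡ-∸; ≤-refl; ≤-reflexive; ≤-trans; ≤-antisym; m≤n+m; m≤n+o⇒m∸n≤o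
        ; ≡ᵇ⇒≡; <⇒<ᵇ; <-cmp; +-*-semiring; module ≤-Reasoning)
open import Data.Fin using (Fin; toℕ) renaming (zero to fzero; suc to fsuc)
open import Data.Fin.Properties using (suc-injective; toℕ-injective; _≟_)
open import Data.Bool using (Bool; true; false; _∧_; not; if_then_else_)
open import Data.Bool.Properties using (∧-zeroʳ; T-≡; not-injective)
open import Data.Product using (Σ; _×_; _,_; proj₁; proj₂)
open import Data.Sum using (_⊎_; inj₁; inj₂)
open import Data.Empty using (⊥; ⊥-elim)
open import Function using (_∘_; case_of_; Equivalence)
open import Relation.Nullary using (¬_; yes; no; contradiction)
open import Relation.Binary.Definitions using (tri<; tri≈; tri>)
open import Relation.Binary.PropositionalEquality
open import Algebra.Properties.Semiring.Sum +-*-semiring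
  using (sum; ∑-comm; ∑-distrib-+; *-distribˡ-sum; *-distribʳ-sum; sum-cong-≗; sum-replicate-zero)

true≢false : ∀ {b} → b ≡ true → b ≢ false
true≢false refl ()

∧-intro : ∀ {a b} → a ≡ true → b ≡ true → a ∧ b ≡ true
∧-intro refl refl = refl

∧-elim : ∀ {a b} → a ∧ b ≡ true → a ≡ true × b ≡ true
∧-elim {true} b≡true = refl , b≡true

∧≡false-right : ∀ {a b} → a ∧ b ≡ false → a ≡ true → b ≡ false
∧≡false-right a∧b≡false refl = a∧b≡false

∧≡false-left : ∀ {a b} → a ∧ b ≡ false → b ≡ true → a ≡ false
∧≡false-left {false} _         _    = refl
∧≡false-left {true}  a∧b≡false refl = a∧b≡false

≡ᵇ-sound : ∀ {m n} → (m ≡ᵇ n) ≡ true → m ≡ n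
≡ᵇ-sound {m} {n} m≡ᵇn = ≡ᵇ⇒≡ m n (Equivalence.from T-≡ m≡ᵇn)

indicator : Bool → ℕ
indicator b = if b then 1 else 0

indicator-*-mono : ∀ b {m n} → (b ≡ true → m ≤ n) → indicator b * m ≤ indicator b * n
indicator-*-mono true  m≤n = *-monoʳ-≤ 1 (m≤n refl)
indicator-*-mono false _   = z≤n

sum-mono-≤ : ∀ {n} {f g : Fin n → ℕ} → (∀ i → f i ≤ g i) → sum f ≤ sum g
sum-mono-≤ {zero}  f≤g = z≤n
sum-mono-≤ {suc n} f≤g = +-mono-≤ (f≤g fzero) (sum-mono-≤ (f≤g ∘ fsuc))

sum-zero : ∀ {n} (f : Fin n → ℕ) → (∀ i → f i ≡ 0) → sum f ≡ 0
sum-zero {n} f f≡0 = trans (sum-cong-≗ f≡0) (sum-replicate-zero n)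

sum-≤1 : ∀ {n} (f : Fin n → ℕ) → (∀ i → f i ≤ 1) →
         (∀ i j → 1 ≤ f i → 1 ≤ f j → i ≡ j) → sum f ≤ 1
sum-≤1 {zero}  f _ _ = z≤n
sum-≤1 {suc n} f f≤1 unique with f fzero in e
... | zero  = sum-≤1 (f ∘ fsuc) (f≤1 ∘ fsuc) (λ i j fi fj → suc-injective (unique _ _ fi fj))
... | suc k = begin
  suc k + sum (f ∘ fsuc)  ≡⟨ cong (suc k +_) (sum-zero (f ∘ fsuc) rest≡0) ⟩
  suc k + 0               ≡⟨ +-identityʳ (suc k) ⟩
  suc k                   ≡⟨ e ⟨
  f fzero                 ≤⟨ f≤1 fzero ⟩
  1                       ∎
  where
  open ≤-Reasoning
  rest≡0 : ∀ i → f (fsuc i) ≡ 0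
  rest≡0 i with f (fsuc i) in e′
  ... | zero  = refl
  ... | suc _ with () ← unique fzero (fsuc i) (subst (1 ≤_) (sym e) (s≤s z≤n)) (subst (1 ≤_) (sym e′) (s≤s z≤n))

countB≡sum : ∀ {n} (f : Fin n → Bool) → countB f ≡ sum (indicator ∘ f)
countB≡sum {zero}  f = refl
countB≡sum {suc n} f = cong (indicator (f fzero) +_) (countB≡sum (f ∘ fsuc))

sum-indicator-* : ∀ {n} (f : Fin n → Bool) c → sum (λ i → indicator (f i) * c) ≡ countB f * c
sum-indicator-* f c = trans (sym (*-distribʳ-sum c (indicator ∘ f))) (cong (_* c) (sym (countB≡sum f)))

countB-double : ∀ {a b} (F : Fin a → Fin b → Bool) →
                sum (λ i → countB (F i)) ≡ sum (λ j → countB (λ i → F i j))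
countB-double F = begin
  sum (λ i → countB (F i))                   ≡⟨ sum-cong-≗ (λ i → countB≡sum (F i)) ⟩
  sum (λ i → sum (λ j → indicator (F i j)))  ≡⟨ ∑-comm (λ i j → indicator (F i j)) ⟩
  sum (λ j → sum (λ i → indicator (F i j)))  ≡⟨ sum-cong-≗ (λ j → countB≡sum (λ i → F i j)) ⟨
  sum (λ j → countB (λ i → F i j))           ∎
  where open ≡-Reasoning

countB-by-incidence : ∀ {a b} (F : Fin a → Fin b → Bool) (f : Fin a → Bool) (g : Fin b → Bool) →
                      (∀ i → countB (F i) ≡ indicator (f i)) →
                      (∀ j → countB (λ i → F i j) ≡ indicator (g j)) → countB f ≡ countB g
countB-by-incidence F f g rows cols = begin
  countB f                          ≡⟨ countB≡sum f ⟩
  sum (indicator ∘ f)               ≡⟨ sum-cong-≗ rows ⟨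
  sum (λ i → countB (F i))          ≡⟨ countB-double F ⟩
  sum (λ j → countB (λ i → F i j))  ≡⟨ sum-cong-≗ cols ⟩
  sum (indicator ∘ g)               ≡⟨ countB≡sum g ⟨
  countB g                          ∎
  where open ≡-Reasoning

countB-false : ∀ {n} (f : Fin n → Bool) → (∀ i → f i ≡ false) → countB f ≡ 0
countB-false f f≡false = trans (countB≡sum f) (sum-zero _ (cong indicator ∘ f≡false))

countB-∧ˡ : ∀ {n} b (f : Fin n → Bool) → countB (λ i → b ∧ f i) ≡ indicator b * countB f
countB-∧ˡ true  f = sym (+-identityʳ (countB f))
countB-∧ˡ false f = countB-false (λ i → false ∧ f i) (λ _ → refl)

countB-∧ˡ-≡1 : ∀ {n} b (f : Fin n → Bool) → (b ≡ true → countB f ≡ 1) → countB (λ i → b ∧ f i) ≡ indicator b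
countB-∧ˡ-≡1 true  f f≡1 = f≡1 refl
countB-∧ˡ-≡1 false f _   = countB-∧ˡ false f

countB-pos : ∀ {n} (f : Fin n → Bool) {i} → f i ≡ true → 1 ≤ countB f
countB-pos f {fzero}  fi rewrite fi = s≤s z≤n
countB-pos f {fsuc i} fi = ≤-trans (countB-pos (f ∘ fsuc) fi) (m≤n+m _ _)

countB≡0⇒false : ∀ {n} (f : Fin n → Bool) → countB f ≡ 0 → ∀ i → f i ≡ false
countB≡0⇒false f f≡0 i with f i in e
... | false = refl
... | true with () ← subst (1 ≤_) f≡0 (countB-pos f e)

countB-≤1 : ∀ {n} (f : Fin n → Bool) → (∀ i j → f i ≡ true → f j ≡ true → i ≡ j) → countB f ≤ 1
countB-≤1 f unique = subst (_≤ 1) (sym (countB≡sum f))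
  (sum-≤1 (indicator ∘ f) (λ i → indicator≤1 (f i))
          (λ i j fi fj → unique i j (positive (f i) fi) (positive (f j) fj)))
  where
  indicator≤1 : ∀ b → indicator b ≤ 1
  indicator≤1 true  = s≤s z≤n
  indicator≤1 false = z≤n
  positive : ∀ b → 1 ≤ indicator b → b ≡ true
  positive true _ = refl

countB≡1 : ∀ {n} (f : Fin n → Bool) {i} → f i ≡ true → (∀ j → f j ≡ true → j ≡ i) → countB f ≡ 1
countB≡1 f fi unique =
  ≤-antisym (countB-≤1 f (λ j k fj fk → trans (unique j fj) (sym (unique k fk)))) (countB-pos f fi)

countB-≥2 : ∀ {n} (f : Fin n → Bool) {i j} → i ≢ j → f i ≡ true → f j ≡ true → 2 ≤ countB f
countB-≥2 f {fzero}  {fzero}  i≢j _ _ = ⊥-elim (i≢j refl)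
countB-≥2 f {fzero}  {fsuc j} _ fi fj rewrite fi = s≤s (countB-pos (f ∘ fsuc) fj)
countB-≥2 f {fsuc i} {fzero}  _ fi fj rewrite fj = s≤s (countB-pos (f ∘ fsuc) fi)
countB-≥2 f {fsuc i} {fsuc j} i≢j fi fj =
  ≤-trans (countB-≥2 (f ∘ fsuc) (i≢j ∘ cong fsuc) fi fj) (m≤n+m _ _)

countB-witness : ∀ {n} (f : Fin n → Bool) → 1 ≤ countB f → Σ (Fin n) λ i → f i ≡ true
countB-witness {suc n} f pos with f fzero in e
... | true  = fzero , e
... | false = let i , fi = countB-witness (f ∘ fsuc) pos in fsuc i , fi

countB-witness₂ : ∀ {n} (f : Fin n → Bool) → 2 ≤ countB f →
                  Σ (Fin n) λ i → Σ (Fin n) λ j → i ≢ j × f i ≡ true × f j ≡ true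
countB-witness₂ {suc n} f two with f fzero in e
... | true  = let j , fj = countB-witness (f ∘ fsuc) (s≤s⁻¹ two) in fzero , fsuc j , (λ ()) , e , fj
... | false = let i , j , i≢j , fi , fj = countB-witness₂ (f ∘ fsuc) two in
              fsuc i , fsuc j , i≢j ∘ suc-injective , fi , fj

countB≡1-unique : ∀ {n} (f : Fin n → Bool) → countB f ≡ 1 → ∀ {i j} → f i ≡ true → f j ≡ true → i ≡ j
countB≡1-unique f one {i} {j} fi fj with i ≟ j
... | yes i≡j = i≡j
... | no  i≢j with s≤s () ← subst (2 ≤_) one (countB-≥2 f i≢j fi fj)

singletons-≗ : ∀ {n} (f g : Fin n → Bool) → countB f ≡ 1 → countB g ≡ 1 →
               ∀ {s} → f s ≡ true → g s ≡ true → ∀ t → f t ≡ g t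
singletons-≗ f g f≡1 g≡1 {s} fs gs t with f t in ft | g t in gt
... | true  | true  = refl
... | false | false = refl
... | true  | false = ⊥-elim (true≢false (subst (λ u → g u ≡ true) (countB≡1-unique f f≡1 fs ft) gs) gt)
... | false | true  = ⊥-elim (true≢false (subst (λ u → f u ≡ true) (countB≡1-unique g g≡1 gs gt) fs) ft)

anyB-intro : ∀ {n} (f : Fin n → Bool) {i} → f i ≡ true → anyB f ≡ true
anyB-intro f {fzero}  fi rewrite fi = refl
anyB-intro f {fsuc i} fi with f fzero
... | true  = refl
... | false = anyB-intro (f ∘ fsuc) fi

anyB≡false : ∀ {n} (f : Fin n → Bool) → anyB f ≡ false → ∀ i → f i ≡ false
anyB≡false f none i with f i in fi
... | false = refl
... | true  = ⊥-elim (true≢false (anyB-intro f fi) none)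

anyB-witness : ∀ {n} (f : Fin n → Bool) → anyB f ≡ true → Σ (Fin n) λ i → f i ≡ true
anyB-witness {suc n} f some with f fzero in e
... | true  = fzero , e
... | false = let i , fi = anyB-witness (f ∘ fsuc) some in fsuc i , fi

-- Abstract form of the double count: the selected classes are the uncovered directions (blocks:
-- their lines, S = P_S) or the unblocked non-adjacency classes (blocks: their points, S = L_S).
module ClassBound {a b d : ℕ} (q : ℕ)
  (selected : Fin a → Bool) (member : Fin a → Fin b → Bool)
  (hits : Fin b → Fin d → Bool) (S : Fin d → Bool)
  (hits⇒S : ∀ {y s} → hits y s ≡ true → S s ≡ true)
  (class-size : ∀ {r} → selected r ≡ true → countB (member r) ≡ q)
  (class-covers : ∀ {r} → selected r ≡ true → ∀ {s} → S s ≡ true →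
                  countB (λ y → member r y ∧ hits y s) ≡ 1)
  (classes-disjoint : ∀ {r r′ y} → selected r ≡ true → selected r′ ≡ true →
                      member r y ≡ true → member r′ y ≡ true → r ≡ r′)
  (traces-separate : ∀ {r r′ y y′} → selected r ≡ true → selected r′ ≡ true →
                     member r y ≡ true → member r′ y′ ≡ true →
                     (∀ s → hits y s ≡ hits y′ s) → y ≡ y′)
  where

  degree : Fin b → ℕ
  degree y = countB (hits y)

  is-untouched is-tangent : Fin a → Fin b → Bool
  is-untouched r y = member r y ∧ (degree y ≡ᵇ 0)
  is-tangent   r y = member r y ∧ (degree y ≡ᵇ 1)

  untouched tangents : Fin a → ℕ
  untouched r = countB (is-untouched r)
  tangents  r = countB (is-tangent r)

  class-hits : ∀ {r} → selected r ≡ true → ∀ s → countB (λ y → member r y ∧ hits y s) ≡ indicator (S s)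
  class-hits {r} sel s with S s in s∈S
  ... | true  = class-covers sel s∈S
  ... | false = countB-false (λ y → member r y ∧ hits y s) (λ y → trans (cong (member r y ∧_) (no-hit y)) (∧-zeroʳ _))
    where
    no-hit : ∀ y → hits y s ≡ false
    no-hit y with hits y s in h
    ... | false = refl
    ... | true  = ⊥-elim (true≢false (hits⇒S h) s∈S)

  S≡degree-sum : ∀ {r} → selected r ≡ true → countB S ≡ sum (λ y → indicator (member r y) * degree y)
  S≡degree-sum {r} sel = begin
    countB S                                          ≡⟨ countB≡sum S ⟩
    sum (indicator ∘ S)                               ≡⟨ sum-cong-≗ (class-hits sel) ⟨
    sum (λ s → countB (λ y → member r y ∧ hits y s))  ≡⟨ countB-double (λ s y → member r y ∧ hits y s) ⟩
    sum (λ y → countB (λ s → member r y ∧ hits y s))  ≡⟨ sum-cong-≗ (λ y → countB-∧ˡ (member r y) (hits y)) ⟩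
    sum (λ y → indicator (member r y) * degree y)     ∎
    where open ≡-Reasoning

  untouched≤1 : ∀ {r} → selected r ≡ true → untouched r ≤ 1
  untouched≤1 sel = countB-≤1 _ λ y y′ uy uy′ →
    let my , dy = ∧-elim uy ; my′ , dy′ = ∧-elim uy′ in
    traces-separate sel sel my my′ λ s →
      trans (countB≡0⇒false (hits y) (≡ᵇ-sound dy) s) (sym (countB≡0⇒false (hits y′) (≡ᵇ-sound dy′) s))

  -- A block of degree d ≥ 2 pays its 2 out of the degree sum; a tangent pays 1 more
  -- by itself and an untouched block 2.
  block-bound : ∀ m d → 2 * indicator m ≤ 2 * indicator (m ∧ (d ≡ᵇ 0))
                                          + (indicator m * d + indicator (m ∧ (d ≡ᵇ 1)))
  block-bound false _             = z≤n
  block-bound true  zero          = ≤-refl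
  block-bound true  (suc zero)    = ≤-refl
  block-bound true  (suc (suc _)) = s≤s (s≤s z≤n)

  class-bound : ∀ {r} → selected r ≡ true → 2 * (q ∸ 1) ≤ countB S + tangents r
  class-bound {r} sel = subst (_≤ countB S + tangents r) (sym (*-distribˡ-∸ 2 q 1))
                              (m≤n+o⇒m∸n≤o (2 * q) 2 twice-size-bound)
    where
    open ≤-Reasoning
    untouched-at tangent-at degree-at : Fin b → ℕ
    untouched-at = indicator ∘ is-untouched r
    tangent-at   = indicator ∘ is-tangent r
    degree-at y  = indicator (member r y) * degree y
    twice-size-bound : 2 * q ≤ 2 + (countB S + tangents r)
    twice-size-bound = begin
      2 * q                                      ≡⟨ cong (2 *_) (trans (sym (class-size sel)) (countB≡sum (member r))) ⟩
      2 * sum (indicator ∘ member r)             ≡⟨ *-distribˡ-sum 2 (indicator ∘ member r) ⟩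
      sum (λ y → 2 * indicator (member r y))     ≤⟨ sum-mono-≤ (λ y → block-bound (member r y) (degree y)) ⟩
      sum (λ y → 2 * untouched-at y + (degree-at y + tangent-at y))
        ≡⟨ ∑-distrib-+ (λ y → 2 * untouched-at y) (λ y → degree-at y + tangent-at y) ⟩
      sum (λ y → 2 * untouched-at y) + sum (λ y → degree-at y + tangent-at y)
        ≡⟨ cong₂ _+_ (sym (*-distribˡ-sum 2 untouched-at)) (∑-distrib-+ degree-at tangent-at) ⟩
      2 * sum untouched-at + (sum degree-at + sum tangent-at)
        ≡⟨ cong₂ _+_ (cong (2 *_) (countB≡sum (is-untouched r)))
                     (cong₂ _+_ (S≡degree-sum sel) (countB≡sum (is-tangent r))) ⟨
      2 * untouched r + (countB S + tangents r)  ≤⟨ +-monoˡ-≤ _ (*-monoʳ-≤ 2 (untouched≤1 sel)) ⟩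
      2 + (countB S + tangents r)                ∎

  tangent-through : Fin a → Fin b → Fin d → Bool
  tangent-through r y s = (selected r ∧ is-tangent r y) ∧ hits y s

  tangent-through-unique : ∀ {r r′ y y′ s} → tangent-through r y s ≡ true → tangent-through r′ y′ s ≡ true →
                           r ≡ r′ × y ≡ y′
  tangent-through-unique {r} {r′} {y} {y′} t t′ =
    let ty , ys = ∧-elim {selected r ∧ is-tangent r y} t ; sel , ty₂ = ∧-elim ty ; my , dy = ∧-elim ty₂
        ty′ , y′s = ∧-elim {selected r′ ∧ is-tangent r′ y′} t′ ; sel′ , ty₂′ = ∧-elim ty′ ; my′ , dy′ = ∧-elim ty₂′
        y≡y′ = traces-separate sel sel′ my my′
                 (singletons-≗ (hits y) (hits y′) (≡ᵇ-sound dy) (≡ᵇ-sound dy′) ys y′s)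
    in classes-disjoint sel sel′ my (subst (λ z → member r′ z ≡ true) (sym y≡y′) my′) , y≡y′

  tangents-through : ∀ s → sum (λ r → countB (λ y → tangent-through r y s)) ≤ indicator (S s)
  tangents-through s with S s in s∈S
  ... | true  = sum-≤1 (λ r → countB (λ y → tangent-through r y s))
    (λ r → countB-≤1 (λ y → tangent-through r y s) (λ y y′ t t′ → proj₂ (tangent-through-unique t t′)))
    (λ r r′ pos pos′ → proj₁ (tangent-through-unique (proj₂ (countB-witness (λ y → tangent-through r y s) pos))
                                                     (proj₂ (countB-witness (λ y → tangent-through r′ y s) pos′))))
  ... | false = ≤-reflexive (sum-zero (λ r → countB (λ y → tangent-through r y s))
                                      (λ r → countB-false (λ y → tangent-through r y s) (no-tangent r)))
    where
    no-tangent : ∀ r y → tangent-through r y s ≡ false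
    no-tangent r y with tangent-through r y s in t
    ... | false = refl
    ... | true  = ⊥-elim (true≢false (hits⇒S (proj₂ (∧-elim t))) s∈S)

  tangent-bound : sum (λ r → indicator (selected r) * tangents r) ≤ countB S
  tangent-bound = begin
    sum (λ r → indicator (selected r) * tangents r)               ≡⟨ sum-cong-≗ selected-tangents ⟨
    sum (λ r → countB (λ y → selected r ∧ is-tangent r y))        ≡⟨ sum-cong-≗ (λ r → countB≡sum (λ y → selected r ∧ is-tangent r y)) ⟩
    sum (λ r → sum (λ y → indicator (selected r ∧ is-tangent r y)))
      ≡⟨ sum-cong-≗ (λ r → sum-cong-≗ (tangent-degree r)) ⟨
    sum (λ r → sum (λ y → countB (tangent-through r y)))          ≡⟨ sum-cong-≗ (λ r → countB-double (tangent-through r)) ⟩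
    sum (λ r → sum (λ s → countB (λ y → tangent-through r y s)))  ≡⟨ ∑-comm (λ r s → countB (λ y → tangent-through r y s)) ⟩
    sum (λ s → sum (λ r → countB (λ y → tangent-through r y s)))  ≤⟨ sum-mono-≤ tangents-through ⟩
    sum (indicator ∘ S)                                           ≡⟨ countB≡sum S ⟨
    countB S                                                      ∎
    where
    open ≤-Reasoning
    selected-tangents : ∀ r → countB (λ y → selected r ∧ is-tangent r y) ≡ indicator (selected r) * tangents r
    selected-tangents r = countB-∧ˡ (selected r) (is-tangent r)
    tangent-degree : ∀ r y → countB (tangent-through r y) ≡ indicator (selected r ∧ is-tangent r y)
    tangent-degree r y = countB-∧ˡ-≡1 (selected r ∧ is-tangent r y) (hits y)
                                      λ t → ≡ᵇ-sound (proj₂ (∧-elim (proj₂ (∧-elim {selected r} t))))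

  bound : 2 * countB selected * (q ∸ 1) ≤ suc (countB selected) * countB S
  bound = begin
    2 * u * (q ∸ 1)                                     ≡⟨ trans (cong (_* (q ∸ 1)) (*-comm 2 u)) (*-assoc u 2 (q ∸ 1)) ⟩
    u * (2 * (q ∸ 1))                                   ≡⟨ sum-indicator-* selected (2 * (q ∸ 1)) ⟨
    sum (λ r → indicator (selected r) * (2 * (q ∸ 1)))  ≤⟨ sum-mono-≤ (λ r → indicator-*-mono (selected r) class-bound) ⟩
    sum (λ r → indicator (selected r) * (P + tangents r))
      ≡⟨ trans (sum-cong-≗ (λ r → *-distribˡ-+ (indicator (selected r)) P (tangents r)))
               (∑-distrib-+ (λ r → indicator (selected r) * P) selected-tangents) ⟩
    sum (λ r → indicator (selected r) * P) + sum selected-tangents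
      ≡⟨ cong (_+ sum selected-tangents) (sum-indicator-* selected P) ⟩
    u * P + sum selected-tangents                       ≤⟨ +-monoʳ-≤ (u * P) tangent-bound ⟩
    u * P + P                                           ≡⟨ +-comm (u * P) P ⟩
    suc u * P                                           ∎
    where
    open ≤-Reasoning
    u P : ℕ
    u = countB selected
    P = countB S
    selected-tangents : Fin a → ℕ
    selected-tangents r = indicator (selected r) * tangents r

module AffinePlaneFacts {q : ℕ} (A : AffinePlane q) where
  open AffinePlane A

  meet-intro : ∀ {p l m} → inc p l ≡ true → inc p m ≡ true → meet l m ≡ true
  meet-intro {p} {l} {m} pl pm = anyB-intro (λ p → inc p l ∧ inc p m) (∧-intro pl pm)

  meet-elim : ∀ {l m} → meet l m ≡ true → Σ (Fin np) λ p → inc p l ≡ true × inc p m ≡ true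
  meet-elim {l} {m} lm = let p , plm = anyB-witness (λ p → inc p l ∧ inc p m) lm in p , ∧-elim plm

  disjoint : ∀ {l m p} → meet l m ≡ false → inc p l ≡ true → inc p m ≡ true → ⊥
  disjoint l∩m pl pm = true≢false (meet-intro pl pm) l∩m

  disjoint-sym : ∀ {l m} → meet l m ≡ false → meet m l ≡ false
  disjoint-sym {l} {m} l∩m with meet m l in m∩l
  ... | false = refl
  ... | true  = let _ , pm , pl = meet-elim m∩l in ⊥-elim (disjoint l∩m pl pm)

  par-refl : ∀ l → par l l ≡ true
  par-refl l with l ≟ l
  ... | yes _   = refl
  ... | no  l≢l = contradiction refl l≢l

  par-intro : ∀ {l m} → (∀ {p} → inc p l ≡ true → inc p m ≡ true → l ≡ m) → par l m ≡ true
  par-intro {l} {m} shared with l ≟ m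
  ... | yes _ = refl
  ... | no l≢m with meet l m in l∩m
  ... | false = refl
  ... | true  = let _ , pl , pm = meet-elim l∩m in contradiction (shared pl pm) l≢m

  par-elim : ∀ {l m} → par l m ≡ true → l ≡ m ⊎ meet l m ≡ false
  par-elim {l} {m} l∥m with l ≟ m
  ... | yes l≡m = inj₁ l≡m
  ... | no  _   = inj₂ (not-injective l∥m)

  ¬par-elim : ∀ {l m} → par l m ≡ false → l ≢ m × meet l m ≡ true
  ¬par-elim {l} {m} l∦m with l ≟ m | meet l m
  ... | no l≢m | true = l≢m , refl

  par-common-point : ∀ {l m p} → par l m ≡ true → inc p l ≡ true → inc p m ≡ true → l ≡ m
  par-common-point l∥m pl pm with par-elim l∥m
  ... | inj₁ l≡m = l≡m
  ... | inj₂ l∩m = ⊥-elim (disjoint l∩m pl pm)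

  par-disjoint : ∀ {l m} → meet l m ≡ false → par l m ≡ true
  par-disjoint l∩m = par-intro (λ pl pm → ⊥-elim (disjoint l∩m pl pm))

  par-sym : ∀ {l m} → par l m ≡ true → par m l ≡ true
  par-sym l∥m = par-intro (λ pm pl → sym (par-common-point l∥m pl pm))

  par-trans : ∀ {l m k} → par l m ≡ true → par m k ≡ true → par l k ≡ true
  par-trans {l} {m} {k} l∥m m∥k with par-elim l∥m | par-elim m∥k
  ... | inj₁ refl | _         = m∥k
  ... | inj₂ _    | inj₁ refl = l∥m
  ... | inj₂ l∩m  | inj₂ m∩k  = par-intro through-common-point
    where
    through-common-point : ∀ {p} → inc p l ≡ true → inc p k ≡ true → l ≡ k
    through-common-point {p} pl pk with inc p m in pm
    ... | true  = ⊥-elim (disjoint l∩m pl pm)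
    ... | false = playfair-uniq p m pm l k pl l∩m pk (disjoint-sym m∩k)

  parallel-through : ∀ m p → Σ (Fin nl) λ l → par l m ≡ true × inc p l ≡ true
  parallel-through m p with inc p m in pm
  ... | true  = m , par-refl m , pm
  ... | false = let k , pk , k∩m = playfair p m pm in k , par-disjoint k∩m , pk

  countB-parallel-through : ∀ m p → countB (λ l → par l m ∧ inc p l) ≡ 1
  countB-parallel-through m p =
    let l , l∥m , pl = parallel-through m p in
    countB≡1 (λ k → par k m ∧ inc p k) (∧-intro l∥m pl) λ k k∥m∧pk →
      let k∥m , pk = ∧-elim k∥m∧pk in par-common-point (par-trans k∥m (par-sym l∥m)) pk pl

  countB-intersection : ∀ {l m} → par l m ≡ false → countB (λ p → inc p m ∧ inc p l) ≡ 1
  countB-intersection {l} {m} l∦m =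
    let l≢m , l∩m = ¬par-elim l∦m ; p , pl , pm = meet-elim l∩m in
    countB≡1 (λ p → inc p m ∧ inc p l) (∧-intro pm pl) λ p′ p′m∧p′l →
      let p′m , p′l = ∧-elim p′m∧p′l in
      case p′ ≟ p of λ where
        (yes p′≡p) → p′≡p
        (no  p′≢p) → contradiction (join-uniq p′ p p′≢p l m p′l pl p′m pm) l≢m

  2≤q : 2 ≤ q
  2≤q = let a , b , _ , a≢b , _ = noncollinear ; n , an , bn = join a b a≢b in
        subst (2 ≤_) (order n) (countB-≥2 (λ p → inc p n) a≢b an bn)

  two-points-on : ∀ l → Σ (Fin np) λ p → Σ (Fin np) λ p′ → p ≢ p′ × inc p l ≡ true × inc p′ l ≡ true
  two-points-on l = countB-witness₂ (λ p → inc p l) (subst (2 ≤_) (sym (order l)) 2≤q)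

module IncidenceGraph {q : ℕ} (A : AffinePlane q) (ℓ₀ : Fin (AffinePlane.nl A)) where
  open Biaffine A ℓ₀

  Adj-sym : ∀ {x y} → Adj x y → Adj y x
  Adj-sym {inj₁ _} {inj₁ _} ()
  Adj-sym {inj₁ _} {inj₂ _} a = a
  Adj-sym {inj₂ _} {inj₁ _} a = a
  Adj-sym {inj₂ _} {inj₂ _} ()

  Adj-bipartite : ∀ {l p z} → Adj (inj₂ l) z → ¬ Adj z (inj₁ p)
  Adj-bipartite {z = inj₁ _} _ ()
  Adj-bipartite {z = inj₂ _} () _

  snoc : ∀ {x y z k} → Walk x y k → Adj y z → Walk x z (suc k)
  snoc here       b = step b here
  snoc (step a w) b = step a (snoc w b)

  reverse : ∀ {x y k} → Walk x y k → Walk y x k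
  reverse here       = here
  reverse (step a w) = snoc (reverse w) (Adj-sym a)

  Dist-sym : ∀ {x y k} → Dist x y k → Dist y x k
  Dist-sym (w , shortest) = reverse w , λ m w′ → shortest m (reverse w′)

  Dist-unique : ∀ {x y k k′} → Dist x y k → Dist x y k′ → k ≡ k′
  Dist-unique (w , shortest) (w′ , shortest′) = ≤-antisym (shortest _ w′) (shortest′ _ w)

  dist-1 : ∀ {x y} → x ≢ y → Adj x y → Dist x y 1
  dist-1 x≢y a = step a here , λ where
    zero    here → contradiction refl x≢y
    (suc _) _    → s≤s z≤n

  dist-2 : ∀ {x y z} → x ≢ y → ¬ Adj x y → Adj x z → Adj z y → Dist x y 2
  dist-2 x≢y ¬a a b = step a (step b here) , λ where
    zero          here           → contradiction refl x≢y
    (suc zero)    (step a′ here) → contradiction a′ ¬a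
    (suc (suc _)) _              → s≤s (s≤s z≤n)

  dist-3 : ∀ {x y} → x ≢ y → ¬ Adj x y → (∀ {z} → Adj x z → ¬ Adj z y) → Walk x y 3 → Dist x y 3
  dist-3 x≢y ¬a ¬ab w = w , λ where
    zero                here                      → contradiction refl x≢y
    (suc zero)          (step a′ here)            → contradiction a′ ¬a
    (suc (suc zero))    (step a′ (step b′ here))  → contradiction b′ (¬ab a′)
    (suc (suc (suc _))) _                         → s≤s (s≤s (s≤s z≤n))

module BiaffineFacts {q : ℕ} (A : AffinePlane q) (ℓ₀ : Fin (AffinePlane.nl A)) where
  open AffinePlane A
  open Biaffine A ℓ₀
  open AffinePlaneFacts A
  open IncidenceGraph A ℓ₀

  kept⇒∦ℓ₀ : ∀ {l} → kept l ≡ true → par l ℓ₀ ≡ false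
  kept⇒∦ℓ₀ = not-injective

  ¬kept⇒∥ℓ₀ : ∀ {l} → kept l ≡ false → par l ℓ₀ ≡ true
  ¬kept⇒∥ℓ₀ = not-injective

  kept-par : ∀ {l m} → par l m ≡ true → kept m ≡ true → kept l ≡ true
  kept-par {l} l∥m km with par l ℓ₀ in l∥ℓ₀
  ... | false = refl
  ... | true  = ⊥-elim (true≢false (par-trans (par-sym l∥m) l∥ℓ₀) (kept⇒∦ℓ₀ km))

  kept-∦-deleted : ∀ {l c} → kept l ≡ true → par c ℓ₀ ≡ true → par l c ≡ false
  kept-∦-deleted {l} {c} kl c∥ℓ₀ with par l c in l∥c
  ... | false = refl
  ... | true  = ⊥-elim (true≢false (par-trans l∥c c∥ℓ₀) (kept⇒∦ℓ₀ kl))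

  -- Of the joins of p with two points of m, at most one can be parallel to ℓ₀.
  kept-join-to-line : ∀ {m p} → kept m ≡ true → inc p m ≡ false →
                      Σ (Fin np) λ r → Σ KeptLine λ n →
                        inc r m ≡ true × inc r (proj₁ n) ≡ true × inc p (proj₁ n) ≡ true
  kept-join-to-line {m} {p} km pm with two-points-on m
  ... | r₁ , r₂ , r₁≢r₂ , r₁m , r₂m with join p r₁ (off-m r₁m) | join p r₂ (off-m r₂m)
    where
    off-m : ∀ {r} → inc r m ≡ true → p ≢ r
    off-m rm refl = true≢false rm pm
  ... | n₁ , pn₁ , r₁n₁ | n₂ , pn₂ , r₂n₂ with kept n₁ in kn₁ | kept n₂ in kn₂
  ... | true  | _     = r₁ , (n₁ , kn₁) , r₁m , r₁n₁ , pn₁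
  ... | false | true  = r₂ , (n₂ , kn₂) , r₂m , r₂n₂ , pn₂
  ... | false | false = ⊥-elim (true≢false (subst (λ l → inc p l ≡ true) n₁≡m pn₁) pm)
    where
    n₁≡n₂ : n₁ ≡ n₂
    n₁≡n₂ = par-common-point (par-trans (¬kept⇒∥ℓ₀ kn₁) (par-sym (¬kept⇒∥ℓ₀ kn₂))) pn₁ pn₂
    n₁≡m : n₁ ≡ m
    n₁≡m = join-uniq r₁ r₂ r₁≢r₂ n₁ m r₁n₁ (subst (λ l → inc r₂ l ≡ true) (sym n₁≡n₂) r₂n₂) r₁m r₂m

  kept-join-off-deleted : ∀ {c p t} → par c ℓ₀ ≡ true → inc p c ≡ true → inc t c ≡ false →
                          Σ KeptLine λ n → inc p (proj₁ n) ≡ true × inc t (proj₁ n) ≡ true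
  kept-join-off-deleted {c} {p} {t} c∥ℓ₀ pc tc with join p t (λ { refl → true≢false pc tc })
  ... | n , pn , tn with kept n in kn
  ... | true  = (n , kn) , pn , tn
  ... | false = ⊥-elim (true≢false (subst (λ l → inc t l ≡ true) n≡c tn) tc)
    where
    n≡c : n ≡ c
    n≡c = par-common-point (par-trans (¬kept⇒∥ℓ₀ kn) (par-sym c∥ℓ₀)) pn pc

  line-point-distance : Bool → ℕ
  line-point-distance incident = if incident then 1 else 3

  dist-line-point : ∀ (l : KeptLine) p → Dist (inj₂ l) (inj₁ p) (line-point-distance (inc p (proj₁ l)))
  dist-line-point l p with inc p (proj₁ l) in pl
  ... | true  = dist-1 (λ ()) pl
  ... | false = let r , n , rl , rn , pn = kept-join-to-line (proj₂ l) pl in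
                dist-3 (λ ()) (λ pl′ → true≢false pl′ pl) Adj-bipartite
                       (step {y = inj₁ r} rl (step {y = inj₂ n} rn (step pn here)))

  dist-meeting-lines : ∀ (l m : KeptLine) → proj₁ l ≢ proj₁ m → meet (proj₁ l) (proj₁ m) ≡ true →
                       Dist (inj₂ l) (inj₂ m) 2
  dist-meeting-lines l m l≢m l∩m =
    let p , pl , pm = meet-elim l∩m in dist-2 {z = inj₁ p} (λ { refl → l≢m refl }) (λ ()) pl pm

  dist-collinear-points : ∀ {p t} (n : KeptLine) → p ≢ t → inc p (proj₁ n) ≡ true → inc t (proj₁ n) ≡ true →
                          Dist (inj₁ p) (inj₁ t) 2
  dist-collinear-points n p≢t pn tn = dist-2 {z = inj₂ n} (λ { refl → p≢t refl }) (λ ()) pn tn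

module ResolvingSetBounds {q : ℕ} (A : AffinePlane q) (ℓ₀ : Fin (AffinePlane.nl A))
  (PS : Fin (AffinePlane.np A) → Bool) (LS : Fin (AffinePlane.nl A) → Bool)
  (resolving : Biaffine.Resolving A ℓ₀ PS LS) where
  open AffinePlane A
  open Biaffine A ℓ₀
  open AffinePlaneFacts A
  open IncidenceGraph A ℓ₀
  open BiaffineFacts A ℓ₀

  Equidistant : Vertex → Vertex → Set
  Equidistant x y = ∀ s → InS PS LS s → ∀ {k₁ k₂} → Dist x s k₁ → Dist y s k₂ → k₁ ≡ k₂

  equidistant-not-distinct : ∀ {x y} → Equidistant x y → ¬ x ≢ y
  equidistant-not-distinct equidistant x≢y =
    let s , s∈S , _ , _ , d , d′ , k≢k′ = proj₂ resolving _ _ x≢y in k≢k′ (equidistant s s∈S d d′)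

  lines-separated : ∀ (l l′ : KeptLine) →
                    (∀ {m} → LS m ≡ true → par (proj₁ l) m ≡ false) →
                    (∀ {m} → LS m ≡ true → par (proj₁ l′) m ≡ false) →
                    (∀ {s} → PS s ≡ true → inc s (proj₁ l) ≡ inc s (proj₁ l′)) → proj₁ l ≡ proj₁ l′
  lines-separated l l′ l∦LS l′∦LS same-points with proj₁ l ≟ proj₁ l′
  ... | yes l≡l′ = l≡l′
  ... | no  l≢l′ = ⊥-elim (equidistant-not-distinct equidistant (λ { refl → l≢l′ refl }))
    where
    equidistant : Equidistant (inj₂ l) (inj₂ l′)
    equidistant (inj₁ s) s∈PS d d′ =
      trans (Dist-unique d (dist-line-point l s))
            (trans (cong line-point-distance (same-points s∈PS)) (Dist-unique (dist-line-point l′ s) d′))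
    equidistant (inj₂ m) m∈LS d d′ =
      let l≢m , l∩m = ¬par-elim (l∦LS m∈LS) ; l′≢m , l′∩m = ¬par-elim (l′∦LS m∈LS) in
      trans (Dist-unique d (dist-meeting-lines l m l≢m l∩m)) (Dist-unique (dist-meeting-lines l′ m l′≢m l′∩m) d′)

  points-separated : ∀ {p p′ c c′} → par c ℓ₀ ≡ true → par c′ ℓ₀ ≡ true →
                     inc p c ≡ true → inc p′ c′ ≡ true →
                     (∀ {t} → PS t ≡ true → inc t c ≡ false) → (∀ {t} → PS t ≡ true → inc t c′ ≡ false) →
                     (∀ {m} → LS m ≡ true → inc p m ≡ inc p′ m) → p ≡ p′
  points-separated {p} {p′} c∥ℓ₀ c′∥ℓ₀ pc p′c′ c∌PS c′∌PS same-lines with p ≟ p′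
  ... | yes p≡p′ = p≡p′
  ... | no  p≢p′ = ⊥-elim (equidistant-not-distinct equidistant (λ { refl → p≢p′ refl }))
    where
    dist-to-PS : ∀ {c p t} → par c ℓ₀ ≡ true → inc p c ≡ true → inc t c ≡ false → Dist (inj₁ p) (inj₁ t) 2
    dist-to-PS c∥ℓ₀ pc tc = let n , pn , tn = kept-join-off-deleted c∥ℓ₀ pc tc in
      dist-collinear-points n (λ { refl → true≢false pc tc }) pn tn
    equidistant : Equidistant (inj₁ p) (inj₁ p′)
    equidistant (inj₁ t) t∈PS d d′ =
      trans (Dist-unique d (dist-to-PS c∥ℓ₀ pc (c∌PS t∈PS))) (Dist-unique (dist-to-PS c′∥ℓ₀ p′c′ (c′∌PS t∈PS)) d′)
    equidistant (inj₂ m) m∈LS d d′ =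
      trans (Dist-unique (Dist-sym d) (dist-line-point m p))
            (trans (cong line-point-distance (same-lines m∈LS)) (Dist-unique (dist-line-point m p′) (Dist-sym d′)))

  first-uncovered : Fin nl → Bool
  first-uncovered m = kept m ∧ not (anyB (λ m′ → (toℕ m′ <ᵇ toℕ m) ∧ par m′ m))
                             ∧ not (anyB (λ m′ → par m m′ ∧ LS m′))

  first-uncovered-elim : ∀ {m} → first-uncovered m ≡ true →
                         kept m ≡ true × (∀ m′ → toℕ m′ < toℕ m → par m′ m ≡ false)
                                       × (∀ {k} → LS k ≡ true → par m k ≡ false)
  first-uncovered-elim {m} first =
    let km , rest = ∧-elim {kept m} first ; none-before , none-in-LS = ∧-elim rest in
    km ,
    (λ m′ m′<m → ∧≡false-right (anyB≡false (λ k → (toℕ k <ᵇ toℕ m) ∧ par k m) (not-injective none-before) m′)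
                               (Equivalence.to T-≡ (<⇒<ᵇ m′<m))) ,
    (λ {k} k∈LS → ∧≡false-left (anyB≡false (λ k → par m k ∧ LS k) (not-injective none-in-LS) k) k∈LS)

  first-uncovered-unique : ∀ {m m′} → first-uncovered m ≡ true → first-uncovered m′ ≡ true →
                           par m m′ ≡ true → m ≡ m′
  first-uncovered-unique {m} {m′} first first′ m∥m′ with <-cmp (toℕ m) (toℕ m′)
  ... | tri< m<m′ _ _ = ⊥-elim (true≢false m∥m′ (proj₁ (proj₂ (first-uncovered-elim first′)) m m<m′))
  ... | tri≈ _ m≡m′ _ = toℕ-injective m≡m′
  ... | tri> _ _ m′<m = ⊥-elim (true≢false (par-sym m∥m′) (proj₁ (proj₂ (first-uncovered-elim first)) m′ m′<m))

  ∥-first-uncovered-∦LS : ∀ {l m k} → first-uncovered m ≡ true → par l m ≡ true → LS k ≡ true → par l k ≡ false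
  ∥-first-uncovered-∦LS {l} {m} {k} first l∥m k∈LS with par l k in l∥k
  ... | false = refl
  ... | true  = ⊥-elim (true≢false (par-trans (par-sym l∥m) l∥k) (proj₂ (proj₂ (first-uncovered-elim first)) k∈LS))

  direction-size : ∀ {m} → kept m ≡ true → countB (λ l → par l m) ≡ q
  direction-size {m} km = trans (countB-by-incidence (λ l p → par l m ∧ (inc p ℓ₀ ∧ inc p l))
                                                     (λ l → par l m) (λ p → inc p ℓ₀) row column)
                                (order ℓ₀)
    where
    row : ∀ l → countB (λ p → par l m ∧ (inc p ℓ₀ ∧ inc p l)) ≡ indicator (par l m)
    row l = countB-∧ˡ-≡1 (par l m) (λ p → inc p ℓ₀ ∧ inc p l) λ l∥m →
      countB-intersection (kept⇒∦ℓ₀ (kept-par l∥m km))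
    column : ∀ p → countB (λ l → par l m ∧ (inc p ℓ₀ ∧ inc p l)) ≡ indicator (inc p ℓ₀)
    column p with inc p ℓ₀
    ... | true  = countB-parallel-through m p
    ... | false = countB-false (λ l → par l m ∧ false) (λ l → ∧-zeroʳ (par l m))

  direction-covers-PS : ∀ {m s} → PS s ≡ true → countB (λ l → par l m ∧ (PS s ∧ inc s l)) ≡ 1
  direction-covers-PS {m} {s} s∈PS rewrite s∈PS = countB-parallel-through m s

  ∥-first-uncovered-separated : ∀ {m m′ l l′} → first-uncovered m ≡ true → first-uncovered m′ ≡ true →
                                par l m ≡ true → par l′ m′ ≡ true →
                                (∀ s → PS s ∧ inc s l ≡ PS s ∧ inc s l′) → l ≡ l′
  ∥-first-uncovered-separated {l = l} {l′} first first′ l∥m l′∥m′ same-trace =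
    lines-separated (l , kept-par l∥m (proj₁ (first-uncovered-elim first)))
                    (l′ , kept-par l′∥m′ (proj₁ (first-uncovered-elim first′)))
      (∥-first-uncovered-∦LS first l∥m) (∥-first-uncovered-∦LS first′ l′∥m′)
      (λ {s} s∈PS → subst (λ b → b ∧ inc s l ≡ b ∧ inc s l′) s∈PS (same-trace s))

  module UncoveredDirections =
    ClassBound q first-uncovered (λ m l → par l m) (λ l s → PS s ∧ inc s l) PS
      (λ {_} {s} → proj₁ ∘ ∧-elim {PS s})
      (direction-size ∘ proj₁ ∘ first-uncovered-elim)
      (λ _ → direction-covers-PS)
      (λ first first′ l∥m l∥m′ → first-uncovered-unique first first′ (par-trans (par-sym l∥m) l∥m′))
      ∥-first-uncovered-separated

  unblocked-class : Fin nl → Bool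
  unblocked-class c = par c ℓ₀ ∧ not (anyB (λ p → inc p c ∧ PS p))

  unblocked-class-elim : ∀ {c} → unblocked-class c ≡ true →
                         par c ℓ₀ ≡ true × (∀ {t} → PS t ≡ true → inc t c ≡ false)
  unblocked-class-elim {c} unblocked =
    let c∥ℓ₀ , blocked-by-none = ∧-elim {par c ℓ₀} unblocked in
    c∥ℓ₀ , λ {t} t∈PS → ∧≡false-left (anyB≡false (λ p → inc p c ∧ PS p) (not-injective blocked-by-none) t) t∈PS

  deleted-line-covers-LS : ∀ {c} → par c ℓ₀ ≡ true → ∀ {l} → LS l ≡ true → countB (λ p → inc p c ∧ (LS l ∧ inc p l)) ≡ 1
  deleted-line-covers-LS {c} c∥ℓ₀ {l} l∈LS rewrite l∈LS =
    countB-intersection (kept-∦-deleted (proj₁ resolving l l∈LS) c∥ℓ₀)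

  points-of-unblocked-separated : ∀ {c c′ p p′} → unblocked-class c ≡ true → unblocked-class c′ ≡ true →
                                  inc p c ≡ true → inc p′ c′ ≡ true →
                                  (∀ l → LS l ∧ inc p l ≡ LS l ∧ inc p′ l) → p ≡ p′
  points-of-unblocked-separated {p = p} {p′} unblocked unblocked′ pc p′c′ same-trace =
    let c∥ℓ₀ , c∌PS = unblocked-class-elim unblocked ; c′∥ℓ₀ , c′∌PS = unblocked-class-elim unblocked′ in
    points-separated c∥ℓ₀ c′∥ℓ₀ pc p′c′ c∌PS c′∌PS
      (λ {m} m∈LS → subst (λ b → b ∧ inc p m ≡ b ∧ inc p′ m) m∈LS (same-trace m))

  module UnblockedClasses =
    ClassBound q unblocked-class (λ c p → inc p c) (λ p l → LS l ∧ inc p l) LS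
      (λ {_} {l} → proj₁ ∘ ∧-elim {LS l})
      (λ {c} _ → order c)
      (λ unblocked → deleted-line-covers-LS (proj₁ (unblocked-class-elim unblocked)))
      (λ unblocked unblocked′ →
         par-common-point (par-trans (proj₁ (unblocked-class-elim unblocked))
                                     (par-sym (proj₁ (unblocked-class-elim unblocked′)))))
      points-of-unblocked-separated

mainTheorem15 : (q : ℕ) (A : AffinePlane q) (ℓ₀ : Fin (AffinePlane.nl A))
                (PS : Fin (AffinePlane.np A) → Bool) (LS : Fin (AffinePlane.nl A) → Bool) →
                Biaffine.Resolving A ℓ₀ PS LS →
                (2 * Biaffine.uncovered A ℓ₀ LS * (q ∸ 1) ≤ suc (Biaffine.uncovered A ℓ₀ LS) * countB PS)
                × (2 * Biaffine.unblocked A ℓ₀ PS * (q ∸ 1) ≤ suc (Biaffine.unblocked A ℓ₀ PS) * countB LS)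
mainTheorem15 q A ℓ₀ PS LS resolving = UncoveredDirections.bound , UnblockedClasses.bound
  where open ResolvingSetBounds A ℓ₀ PS LS resolving
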